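{- The reflection rule is admissible in $\mathsf{IEL}^{ - }$: for every formula $A$, if $\mathsf{IEL}^{ - }\vdash\Box A$ then $\mathsf{IEL}^{ - }\vdash A$.
   Context: Formulas: built from propositional atoms and $\bot$ by $\wedge,\vee,\rightarrow$ and a unary modality $\Box$. $\mathsf{IEL}^{ - }$ is the natural deduction system with the usual intuitionistic (NJ) introduction/elimination rules for $\wedge,\vee,\rightarrow$, ex falso ($\bot$-elimination), and the $\Box$-intro rule: from deductions of $\Box A_1,\dots,\Box A_n$ (from assumptions $\Gamma_1,\dots,\Gamma_n$) and a deduction of $B$ from assumptions $A_1,\dots,A_n,\Delta$, infer $\Box B$, discharging $A_1,\dots,A_n$ ($n\ge0$). $\mathsf{IEL}^{ - }\vdash A$ means $A$ has a deduction with no undischarged assumptions. -}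

module Defs where

open import Data.Nat using (ℕ)
open import Data.List using (List; []; _∷_; _++_)
open import Data.List.Membership.Propositional using (_∈_)
open import Data.List.Relation.Unary.All using (All)

data Fm : Set where
  atom : ℕ → Fm
  ⊥'   : Fm
  _∧'_ : Fm → Fm → Fm
  _∨'_ : Fm → Fm → Fm
  _⇒_  : Fm → Fm → Fm
  □_   : Fm → Fm

infixr 6 _∧'_
infixr 5 _∨'_
infixr 4 _⇒_
infix 7 □_

Ctx : Set
Ctx = List Fm

infix 3 _⊢_
data _⊢_ (Γ : Ctx) : Fm → Set where
  hyp   : ∀ {A} → A ∈ Γ → Γ ⊢ A
  ∧I    : ∀ {A B} → Γ ⊢ A → Γ ⊢ B → Γ ⊢ A ∧' B
  ∧E₁   : ∀ {A B} → Γ ⊢ A ∧' B → Γ ⊢ A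
  ∧E₂   : ∀ {A B} → Γ ⊢ A ∧' B → Γ ⊢ B
  ∨I₁   : ∀ {A B} → Γ ⊢ A → Γ ⊢ A ∨' B
  ∨I₂   : ∀ {A B} → Γ ⊢ B → Γ ⊢ A ∨' B
  ∨E    : ∀ {A B C} → Γ ⊢ A ∨' B → A ∷ Γ ⊢ C → B ∷ Γ ⊢ C → Γ ⊢ C
  ⇒I    : ∀ {A B} → A ∷ Γ ⊢ B → Γ ⊢ A ⇒ B
  ⇒E    : ∀ {A B} → Γ ⊢ A ⇒ B → Γ ⊢ A → Γ ⊢ B
  ⊥E    : ∀ {A} → Γ ⊢ ⊥' → Γ ⊢ A
  -- □-intro: from deductions of □A₁,…,□Aₙ and a deduction of B from
  -- A₁,…,Aₙ together with further assumptions (Γ), infer □B,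
  -- discharging A₁,…,Aₙ (n ≥ 0).
  □I    : ∀ {B} (As : List Fm) → All (λ A → Γ ⊢ □ A) As → As ++ Γ ⊢ B → Γ ⊢ □ B

IEL⁻⊢_ : Fm → Set
IEL⁻⊢ A = [] ⊢ A

{-# OPTIONS --safe #-}
-- Gluing (an Aczel slash): a closed formula is realized when it is provable
-- and, hereditarily, its proof "means what it says"; in particular a realizer
-- of □ B carries a realizer of B.  Every closed derivation is sound for this
-- realizability, and realizers reify back into derivations, so a closed proof
-- of □ A yields a realizer of A and hence a closed proof of A.
module Submission where

open import Defs
open import Data.List using ([]; _∷_; _++_)
open import Data.List.Relation.Binary.Subset.Propositional using (_⊆_)
open import Data.List.Relation.Binary.Subset.Propositional.Properties
  using (∷⁺ʳ; ++⁺ʳ; xs⊆xs++ys; xs⊆ys++xs)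
open import Data.List.Relation.Unary.All as All using (All; []; _∷_; lookup)
open import Data.List.Relation.Unary.All.Properties using (++⁺)
open import Data.Sum using (_⊎_; inj₁; inj₂)
open import Data.Product using (_×_; _,_; proj₁; proj₂)
open import Data.Empty using (⊥)

mutual
  weaken : ∀ {Γ Δ A} → Γ ⊆ Δ → Γ ⊢ A → Δ ⊢ A
  weaken ρ (hyp x)      = hyp (ρ x)
  weaken ρ (∧I d e)     = ∧I (weaken ρ d) (weaken ρ e)
  weaken ρ (∧E₁ d)      = ∧E₁ (weaken ρ d)
  weaken ρ (∧E₂ d)      = ∧E₂ (weaken ρ d)
  weaken ρ (∨I₁ d)      = ∨I₁ (weaken ρ d)
  weaken ρ (∨I₂ d)      = ∨I₂ (weaken ρ d)
  weaken ρ (∨E d e f)   = ∨E (weaken ρ d) (weaken (∷⁺ʳ _ ρ) e) (weaken (∷⁺ʳ _ ρ) f)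
  weaken ρ (⇒I d)       = ⇒I (weaken (∷⁺ʳ _ ρ) d)
  weaken ρ (⇒E d e)     = ⇒E (weaken ρ d) (weaken ρ e)
  weaken ρ (⊥E d)       = ⊥E (weaken ρ d)
  weaken ρ (□I As ps d) = □I As (weakenAll ρ ps) (weaken (++⁺ʳ As ρ) d)

  weakenAll : ∀ {Γ Δ As} → Γ ⊆ Δ → All (λ A → Γ ⊢ □ A) As → All (λ A → Δ ⊢ □ A) As
  weakenAll ρ []       = []
  weakenAll ρ (p ∷ ps) = weaken ρ p ∷ weakenAll ρ ps

infix 3 _⊢*_

_⊢*_ : Ctx → Ctx → Set
Δ ⊢* Γ = All (Δ ⊢_) Γ

⊢*-⊆ : ∀ {Γ Δ} → Γ ⊆ Δ → Δ ⊢* Γ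
⊢*-⊆ ρ = All.tabulate (λ x → hyp (ρ x))

⊢*-extend : ∀ {Γ Δ} As → Δ ⊢* Γ → As ++ Δ ⊢* As ++ Γ
⊢*-extend {Δ = Δ} As σ =
  ++⁺ (⊢*-⊆ (xs⊆xs++ys As Δ)) (All.map (weaken (xs⊆ys++xs Δ As)) σ)

mutual
  substitute : ∀ {Γ Δ A} → Δ ⊢* Γ → Γ ⊢ A → Δ ⊢ A
  substitute σ (hyp x)      = lookup σ x
  substitute σ (∧I d e)     = ∧I (substitute σ d) (substitute σ e)
  substitute σ (∧E₁ d)      = ∧E₁ (substitute σ d)
  substitute σ (∧E₂ d)      = ∧E₂ (substitute σ d)
  substitute σ (∨I₁ d)      = ∨I₁ (substitute σ d)
  substitute σ (∨I₂ d)      = ∨I₂ (substitute σ d)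
  substitute σ (∨E d e f)   =
    ∨E (substitute σ d) (substitute (⊢*-extend (_ ∷ []) σ) e) (substitute (⊢*-extend (_ ∷ []) σ) f)
  substitute σ (⇒I d)       = ⇒I (substitute (⊢*-extend (_ ∷ []) σ) d)
  substitute σ (⇒E d e)     = ⇒E (substitute σ d) (substitute σ e)
  substitute σ (⊥E d)       = ⊥E (substitute σ d)
  substitute σ (□I As ps d) = □I As (substituteAll σ ps) (substitute (⊢*-extend As σ) d)

  substituteAll : ∀ {Γ Δ As} → Δ ⊢* Γ → All (λ A → Γ ⊢ □ A) As → All (λ A → Δ ⊢ □ A) As
  substituteAll σ []       = []
  substituteAll σ (p ∷ ps) = substitute σ p ∷ substituteAll σ ps

infix 3 ⊩_

⊩_ : Fm → Set
⊩ atom n   = [] ⊢ atom n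
⊩ ⊥'       = ⊥
⊩ (A ∧' B) = ⊩ A × ⊩ B
⊩ (A ∨' B) = ⊩ A ⊎ ⊩ B
⊩ (A ⇒ B)  = ([] ⊢ A ⇒ B) × (⊩ A → ⊩ B)
⊩ (□ B)    = ([] ⊢ □ B) × ⊩ B

reify : ∀ A → ⊩ A → [] ⊢ A
reify (atom n) p        = p
reify (A ∧' B) (p , q)  = ∧I (reify A p) (reify B q)
reify (A ∨' B) (inj₁ p) = ∨I₁ (reify A p)
reify (A ∨' B) (inj₂ q) = ∨I₂ (reify B q)
reify (A ⇒ B) (d , _)   = d
reify (□ B) (d , _)     = d

closing : ∀ {Γ} → All ⊩_ Γ → [] ⊢* Γ
closing = All.map (λ {C} → reify C)

mutual
  sound : ∀ {Γ A} → Γ ⊢ A → All ⊩_ Γ → ⊩ A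
  sound (hyp x) ρ = lookup ρ x
  sound (∧I d e) ρ = sound d ρ , sound e ρ
  sound (∧E₁ d) ρ = proj₁ (sound d ρ)
  sound (∧E₂ d) ρ = proj₂ (sound d ρ)
  sound (∨I₁ d) ρ = inj₁ (sound d ρ)
  sound (∨I₂ d) ρ = inj₂ (sound d ρ)
  sound (∨E d e f) ρ with sound d ρ
  ... | inj₁ a = sound e (a ∷ ρ)
  ... | inj₂ b = sound f (b ∷ ρ)
  sound (⇒I d) ρ = substitute (closing ρ) (⇒I d) , λ a → sound d (a ∷ ρ)
  sound (⇒E d e) ρ = proj₂ (sound d ρ) (sound e ρ)
  sound (⊥E d) ρ with sound d ρ
  ... | ()
  sound (□I As ps d) ρ = substitute (closing ρ) (□I As ps d) , sound d (++⁺ (soundAll ps ρ) ρ)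

  soundAll : ∀ {Γ As} → All (λ A → Γ ⊢ □ A) As → All ⊩_ Γ → All ⊩_ As
  soundAll []       ρ = []
  soundAll (p ∷ ps) ρ = proj₂ (sound p ρ) ∷ soundAll ps ρ

corollary32 : (A : Fm) → IEL⁻⊢ (□ A) → IEL⁻⊢ A
corollary32 A d = reify A (proj₂ (sound d []))
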